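{- Assume $I_S\neq\emptyset$ (so that $a_{eff}$ is defined). Let $0\le v\le c=1$. Then $$\mathrm{OPT}_{c-v}(\{a_{eff}\})\ge\mathrm{OPT}_{c-v}(I_S)-T$$ and $$\mathrm{OPT}_v(I_L^{red})\ge\left(1-\frac{\varepsilon}{4}\cdot\frac{1}{\log_2(2/\varepsilon)+1}\right)\mathrm{OPT}_v(I_L).$$
   Context: UKP instance $I$: $n$ items with profits $p(a)\in(0,1]$ and sizes $s(a)\in(0,1]$, capacity $c=1$. A solution is a multiset of items (nonnegative integer multiplicities $x_a$). For a set $I'$ of items and $0\le v\le c$, $\mathrm{OPT}_v(I')=\max\{\sum_{a\in I'}p(a)x_a : \sum_{a\in I'}s(a)x_a\le v,\ x_a\in\mathbb{N}\}$, and $\mathrm{OPT}(I')=\mathrm{OPT}_c(I')$. Let $\varepsilon=1/2^{\kappa-1}$ with $\kappa\in\mathbb{N}$ and $\varepsilon\le 1/4$ (so $\log_2(2/\varepsilon)=\kappa$). Let $a_{me}$ be an item of $I$ maximizing $p(a)/s(a)$, $P_0=p(a_{me})\lfloor c/s(a_{me})\rfloor$, $T=\frac12\varepsilon P_0$, and $K=\frac14\cdot\frac{1}{\kappa+1}\varepsilon T$. Let $I_L=\{a\in I: p(a)\ge T\}$, $I_S=I\setminus I_L$, and let $a_{eff}$ be an item of $I_S$ maximizing $p(a)/s(a)$. For $k\in\{0,\dots,\kappa\}$ and $\gamma\in\{0,\dots,2^{\kappa+1}(\kappa+1)-1\}$ let $L_{k,\gamma}=[2^kT+\gamma 2^kK,\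 2^kT+(\gamma+1)2^kK)$, and let $L_{\kappa+1,0}=\{2P_0\}$ (these sets partition $[T,2P_0]$, which contains every profit of $I_L$). For each such $(k,\gamma)$ let $a_{k,\gamma}$ be an item of minimum size among the items of $I_L$ with profit in $L_{k,\gamma}$ (nonexistent if there is none), and let $I_L^{red}$ be the set of all existing $a_{k,\gamma}$.
   Formalization: The profits and sizes of the items and the bound $v$ are rational. -}

module Defs where

open import Data.Nat as ℕ using (ℕ; zero; suc; _∸_; _^_)
open import Data.Fin using (Fin; zero; suc)
open import Data.Integer using (+_)
open import Data.Rational using (ℚ; 0ℚ; 1ℚ; _+_; _*_; _-_; _≤_; _<_; _÷_; _/_; floor; positive)
open import Data.Rational.Properties using (pos⇒nonZero)
open import Data.Nat.Properties using (m^n≢0)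
open import Data.Product using (Σ; _×_; ∃)
open import Data.Sum using (_⊎_)
open import Relation.Binary.PropositionalEquality using (_≡_)
open import Relation.Nullary using (¬_)

ℕ→ℚ : ℕ → ℚ
ℕ→ℚ m = + m / 1

sumFin : (n : ℕ) → (Fin n → ℚ) → ℚ
sumFin zero    f = 0ℚ
sumFin (suc n) f = f zero + sumFin n (λ i → f (suc i))

ratio : ℚ → (s : ℚ) → 0ℚ < s → ℚ
ratio p s pos = (p ÷ s) {{pos⇒nonZero s {{positive pos}}}}

1/2^ : ℕ → ℚ
1/2^ m = (+ 1 / (2 ^ m)) {{m^n≢0 2 m}}

⌊_⌋ℚ : ℚ → ℚ
⌊ q ⌋ℚ = floor q / 1

-- A UKP instance with n items (indexed by Fin n), profits p and sizes s,
-- capacity c = 1.  A set of items I' ⊆ I is a predicate on Fin n.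
-- A solution is a multiplicity vector x : Fin n → ℕ.
module _ {n : ℕ} (p s : Fin n → ℚ) where

  profitOf : (Fin n → ℕ) → ℚ
  profitOf x = sumFin n (λ a → p a * ℕ→ℚ (x a))

  sizeOf : (Fin n → ℕ) → ℚ
  sizeOf x = sumFin n (λ a → s a * ℕ→ℚ (x a))

  Feasible : (Fin n → Set) → ℚ → (Fin n → ℕ) → Set
  Feasible I' v x = (∀ a → ¬ I' a → x a ≡ 0) × (sizeOf x ≤ v)

  IsOPT : (Fin n → Set) → ℚ → ℚ → Set
  IsOPT I' v o =
    (Σ (Fin n → ℕ) λ x → Feasible I' v x × profitOf x ≡ o)
    × (∀ x → Feasible I' v x → profitOf x ≤ o)

ValidIdx : ℕ → ℕ → ℕ → Set
ValidIdx κ k γ =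
  (k ℕ.≤ κ × γ ℕ.< 2 ^ (suc κ) ℕ.* suc κ) ⊎ (k ≡ suc κ × γ ≡ 0)

InL : (κ : ℕ) (T K P0 : ℚ) → ℕ → ℕ → ℚ → Set
InL κ T K P0 k γ q =
  (k ℕ.≤ κ × γ ℕ.< 2 ^ (suc κ) ℕ.* suc κ
    × ℕ→ℚ (2 ^ k) * T + ℕ→ℚ γ * ℕ→ℚ (2 ^ k) * K ≤ q
    × q < ℕ→ℚ (2 ^ k) * T + ℕ→ℚ (suc γ) * ℕ→ℚ (2 ^ k) * K)
  ⊎ (k ≡ suc κ × γ ≡ 0 × q ≡ ℕ→ℚ 2 * P0)

-- Small items: every small item is at most as efficient as a_eff, so a small solution of size at
-- most c − v earns at most eff(a_eff)·(c − v), while ⌊(c − v)/s(a_eff)⌋ copies of a_eff earn more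
-- than eff(a_eff)·(c − v) − p(a_eff), and p(a_eff) < T.
-- Large items: p(a) ≤ eff(a_me)·s(a) ≤ 2P₀, so every large profit lies in some class L_{k,γ}. The
-- width 2^k K of that class is δ·2^k T ≤ δ·q for each profit q in it (δ = ε/4 · 1/(κ+1)), so the
-- selected item a_{k,γ} is no larger than a and has profit at least (1 − δ)·p(a). Moving every copy
-- of a large item in an optimal solution onto the selected item of its class keeps the solution
-- feasible and loses at most a factor 1 − δ.
module Submission where

open import Defs
open import Data.Nat as ℕ using (ℕ; zero; suc; _∸_; _^_)
open import Data.Integer as ℤ using (+_; -[1+_])
import Data.Integer.Properties as ℤ
import Data.Nat.Properties as ℕ
import Data.Nat.DivMod as ℕ
open import Data.Rational using (ℚ; mkℚ; 0ℚ; 1ℚ; ½; _+_; _*_; _-_; -_; _≤_; _<_; _/_; toℚᵘ; positive; nonNegative; *≤*)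
open import Data.Rational.Properties
open import Data.Rational.Unnormalised as ℚᵘ using (mkℚᵘ; _≃_; *≡*)
import Data.Rational.Unnormalised.Properties as ℚᵘ
open import Data.Product as Product using (Σ; Σ-syntax; _×_; _,_; proj₁; proj₂)
open import Relation.Binary.PropositionalEquality
open import Relation.Nullary using (¬_; contradiction; Dec; yes; no)
open import Relation.Unary using (Decidable)
open import Data.Sum as Sum using (_⊎_; inj₁; inj₂)
open import Data.Maybe using (Maybe; just; nothing)
open import Data.Fin using (Fin; zero; suc)
open import Function using (_∘_; id)
open import Algebra.Bundles using (CommutativeRing)
open import Algebra.Properties.Semiring.Sum (CommutativeRing.semiring +-*-commutativeRing)
  using (sum; sum-cong-≗; sum-replicate-zero; ∑-comm; *-distribˡ-sum)
import Algebra.Properties.Monoid.Sum ℕ.+-0-monoid as ℕΣ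
open import Data.Rational.Solver using (module +-*-Solver)
open +-*-Solver using (solve; _:+_; _:*_; _:-_; _:=_; con)

toℚᵘ-ℕ→ℚ : ∀ m → toℚᵘ (ℕ→ℚ m) ≃ mkℚᵘ (+ m) 0
toℚᵘ-ℕ→ℚ m = toℚᵘ-fromℚᵘ (mkℚᵘ (+ m) 0)

ℕ→ℚ-homo-+ : ∀ a b → ℕ→ℚ (a ℕ.+ b) ≡ ℕ→ℚ a + ℕ→ℚ b
ℕ→ℚ-homo-+ a b = toℚᵘ-injective (begin-equality
  toℚᵘ (ℕ→ℚ (a ℕ.+ b))              ≃⟨ toℚᵘ-ℕ→ℚ (a ℕ.+ b) ⟩
  mkℚᵘ (+ (a ℕ.+ b)) 0               ≃⟨ *≡* (cong (ℤ._* + 1) +-pos) ⟩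
  mkℚᵘ (+ a) 0 ℚᵘ.+ mkℚᵘ (+ b) 0    ≃⟨ ℚᵘ.+-cong (toℚᵘ-ℕ→ℚ a) (toℚᵘ-ℕ→ℚ b) ⟨
  toℚᵘ (ℕ→ℚ a) ℚᵘ.+ toℚᵘ (ℕ→ℚ b)    ≃⟨ toℚᵘ-homo-+ (ℕ→ℚ a) (ℕ→ℚ b) ⟨
  toℚᵘ (ℕ→ℚ a + ℕ→ℚ b)               ∎)
  where
  open ℚᵘ.≤-Reasoning
  +-pos : + (a ℕ.+ b) ≡ + a ℤ.* + 1 ℤ.+ + b ℤ.* + 1
  +-pos = trans (ℤ.pos-+ a b) (sym (cong₂ ℤ._+_ (ℤ.*-identityʳ (+ a)) (ℤ.*-identityʳ (+ b))))

ℕ→ℚ-homo-* : ∀ a b → ℕ→ℚ (a ℕ.* b) ≡ ℕ→ℚ a * ℕ→ℚ b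
ℕ→ℚ-homo-* a b = toℚᵘ-injective (begin-equality
  toℚᵘ (ℕ→ℚ (a ℕ.* b))              ≃⟨ toℚᵘ-ℕ→ℚ (a ℕ.* b) ⟩
  mkℚᵘ (+ (a ℕ.* b)) 0               ≃⟨ *≡* (cong (ℤ._* + 1) (ℤ.pos-* a b)) ⟩
  mkℚᵘ (+ a) 0 ℚᵘ.* mkℚᵘ (+ b) 0    ≃⟨ ℚᵘ.*-cong (toℚᵘ-ℕ→ℚ a) (toℚᵘ-ℕ→ℚ b) ⟨
  toℚᵘ (ℕ→ℚ a) ℚᵘ.* toℚᵘ (ℕ→ℚ b)    ≃⟨ toℚᵘ-homo-* (ℕ→ℚ a) (ℕ→ℚ b) ⟨
  toℚᵘ (ℕ→ℚ a * ℕ→ℚ b)               ∎)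
  where open ℚᵘ.≤-Reasoning

ℕ→ℚ-suc : ∀ m → ℕ→ℚ (suc m) ≡ 1ℚ + ℕ→ℚ m
ℕ→ℚ-suc = ℕ→ℚ-homo-+ 1

ℕ→ℚ-2* : ∀ x → ℕ→ℚ 2 * x ≡ x + x
ℕ→ℚ-2* x = trans (*-distribʳ-+ x 1ℚ 1ℚ) (cong₂ _+_ (*-identityˡ x) (*-identityˡ x))

ℕ→ℚ-nonNeg : ∀ m → 0ℚ ≤ ℕ→ℚ m
ℕ→ℚ-nonNeg m = nonNegative⁻¹ (ℕ→ℚ m) {{normalize-nonNeg m 1}}

1≤ℕ→ℚ-suc : ∀ m → 1ℚ ≤ ℕ→ℚ (suc m)
1≤ℕ→ℚ-suc m = subst (1ℚ ≤_) (sym (ℕ→ℚ-suc m)) (+-monoʳ-≤ 1ℚ (ℕ→ℚ-nonNeg m))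

ℕ→ℚ-2^[2+k] : ∀ k → ℕ→ℚ (2 ^ suc (suc k)) ≡ ℕ→ℚ 2 * (ℕ→ℚ 2 * ℕ→ℚ (2 ^ k))
ℕ→ℚ-2^[2+k] k = trans (ℕ→ℚ-homo-* 2 (2 ^ suc k)) (cong (ℕ→ℚ 2 *_) (ℕ→ℚ-homo-* 2 (2 ^ k)))

1/n*n≡1 : ∀ m .{{_ : ℕ.NonZero m}} → (+ 1 / m) * ℕ→ℚ m ≡ 1ℚ
1/n*n≡1 (suc m) = toℚᵘ-injective (begin-equality
  toℚᵘ ((+ 1 / suc m) * ℕ→ℚ (suc m))                    ≃⟨ toℚᵘ-homo-* (+ 1 / suc m) (ℕ→ℚ (suc m)) ⟩
  toℚᵘ (+ 1 / suc m) ℚᵘ.* toℚᵘ (ℕ→ℚ (suc m))            ≃⟨ ℚᵘ.*-cong (toℚᵘ-fromℚᵘ (mkℚᵘ (+ 1) m)) (toℚᵘ-ℕ→ℚ (suc m)) ⟩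
  mkℚᵘ (+ 1) m ℚᵘ.* mkℚᵘ (+ suc m) 0                     ≃⟨ *≡* (cong (λ k → + suc k) m+0≡m*1+0) ⟩
  toℚᵘ 1ℚ                                                ∎)
  where
  open ℚᵘ.≤-Reasoning
  m+0≡m*1+0 : (m ℕ.+ 0) ℕ.* 1 ≡ m ℕ.* 1 ℕ.+ 0
  m+0≡m*1+0 = trans (ℕ.*-identityʳ (m ℕ.+ 0)) (cong (ℕ._+ 0) (sym (ℕ.*-identityʳ m)))

1/n-pos : ∀ m .{{_ : ℕ.NonZero m}} → 0ℚ < + 1 / m
1/n-pos m = positive⁻¹ (+ 1 / m) {{normalize-pos 1 m}}

1/2^-pos : ∀ k → 0ℚ < 1/2^ k
1/2^-pos k = 1/n-pos (2 ^ k) {{ℕ.m^n≢0 2 k}}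

1/2^*2^≡1 : ∀ k → 1/2^ k * ℕ→ℚ (2 ^ k) ≡ 1ℚ
1/2^*2^≡1 k = 1/n*n≡1 (2 ^ k) {{ℕ.m^n≢0 2 k}}

⌊⌋ℚ-nonNeg : ∀ q → 0ℚ ≤ q → Σ[ m ∈ ℕ ] ⌊ q ⌋ℚ ≡ ℕ→ℚ m × ℕ→ℚ m ≤ q × q < ℕ→ℚ (suc m)
⌊⌋ℚ-nonNeg (mkℚ -[1+ n ] d c) (*≤* ())
⌊⌋ℚ-nonNeg (mkℚ (+ n) d c) _ = m , cong (_/ 1) (ℤ.*-identityˡ (+ m)) , m≤q , q<m+1
  where
  m : ℕ
  m = n ℕ./ suc d
  m*d≤n : m ℕ.* suc d ℕ.≤ n ℕ.* 1
  m*d≤n = ℕ.≤-trans (ℕ.m/n*n≤m n (suc d)) (ℕ.≤-reflexive (sym (ℕ.*-identityʳ n)))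
  n<[m+1]*d : n ℕ.* 1 ℕ.< suc m ℕ.* suc d
  n<[m+1]*d = ℕ.≤-<-trans (ℕ.≤-reflexive (trans (ℕ.*-identityʳ n) (ℕ.m≡m%n+[m/n]*n n (suc d))))
                (ℕ.+-monoˡ-< (m ℕ.* suc d) (ℕ.m%n<n n (suc d)))
  m≤q : ℕ→ℚ m ≤ mkℚ (+ n) d c
  m≤q = toℚᵘ-cancel-≤ (ℚᵘ.≤-respˡ-≃ (ℚᵘ.≃-sym (toℚᵘ-ℕ→ℚ m))
          (ℚᵘ.*≤* (subst₂ ℤ._≤_ (ℤ.pos-* m (suc d)) (ℤ.pos-* n 1) (ℤ.+≤+ m*d≤n))))
  q<m+1 : mkℚ (+ n) d c < ℕ→ℚ (suc m)
  q<m+1 = toℚᵘ-cancel-< (ℚᵘ.<-respʳ-≃ (ℚᵘ.≃-sym (toℚᵘ-ℕ→ℚ (suc m)))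
            (ℚᵘ.*<* (subst₂ ℤ._<_ (ℤ.pos-* n 1) (ℤ.pos-* (suc m) (suc d)) (ℤ.+<+ n<[m+1]*d))))

x≤2⌊x⌋ : ∀ x → 1ℚ ≤ x → Σ[ m ∈ ℕ ] ⌊ x ⌋ℚ ≡ ℕ→ℚ (suc m) × x ≤ ℕ→ℚ 2 * ℕ→ℚ (suc m)
x≤2⌊x⌋ x 1≤x with ⌊⌋ℚ-nonNeg x (≤-trans (nonNegative⁻¹ 1ℚ) 1≤x)
... | zero    , _     , _ , x<1   = contradiction (<-≤-trans x<1 1≤x) (<-irrefl refl)
... | suc m , ⌊x⌋≡M , _ , x<M+1 = m , ⌊x⌋≡M , <⇒≤ (begin-strict
  x                    <⟨ x<M+1 ⟩
  ℕ→ℚ (suc (suc m))    ≡⟨ ℕ→ℚ-suc (suc m) ⟩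
  1ℚ + M               ≤⟨ +-monoˡ-≤ M (1≤ℕ→ℚ-suc m) ⟩
  M + M                ≡⟨ ℕ→ℚ-2* M ⟨
  ℕ→ℚ 2 * M            ∎)
  where
  open ≤-Reasoning
  M : ℚ
  M = ℕ→ℚ (suc m)

p≤q⇒0≤q-p : ∀ {p q} → p ≤ q → 0ℚ ≤ q - p
p≤q⇒0≤q-p {p} {q} p≤q = subst (_≤ q - p) (+-inverseʳ p) (+-monoˡ-≤ (- p) p≤q)

p≤q+r⇒p-r≤q : ∀ {p q r} → p ≤ q + r → p - r ≤ q
p≤q+r⇒p-r≤q {p} {q} {r} p≤q+r = begin
  p - r          ≤⟨ +-monoˡ-≤ (- r) p≤q+r ⟩
  q + r - r      ≡⟨ +-assoc q r (- r) ⟩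
  q + (r - r)    ≡⟨ cong (_+_ q) (+-inverseʳ r) ⟩
  q + 0ℚ         ≡⟨ +-identityʳ q ⟩
  q              ∎
  where open ≤-Reasoning

p≤p+q : ∀ {p q} → 0ℚ ≤ q → p ≤ p + q
p≤p+q {p} 0≤q = subst (_≤ p + _) (+-identityʳ p) (+-monoʳ-≤ p 0≤q)

*-pos : ∀ {p q} → 0ℚ < p → 0ℚ < q → 0ℚ < p * q
*-pos {p} {q} 0<p 0<q = positive⁻¹ (p * q) {{pos*pos⇒pos p {{positive 0<p}} q {{positive 0<q}}}}

*-nonNeg : ∀ {p q} → 0ℚ ≤ p → 0ℚ ≤ q → 0ℚ ≤ p * q
*-nonNeg {p} {q} 0≤p 0≤q = nonNegative⁻¹ (p * q) {{nonNeg*nonNeg⇒nonNeg p {{nonNegative 0≤p}} q {{nonNegative 0≤q}}}}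

q≤q′+δq⇒[1-δ]q≤q′ : ∀ δ {q q′} → q ≤ q′ + δ * q → (1ℚ - δ) * q ≤ q′
q≤q′+δq⇒[1-δ]q≤q′ δ {q} {q′} q≤q′+δq = begin
  (1ℚ - δ) * q     ≡⟨ solve 2 (λ d q → (con 1ℚ :- d) :* q := q :- d :* q) refl δ q ⟩
  q - δ * q        ≤⟨ p≤q+r⇒p-r≤q q≤q′+δq ⟩
  q′               ∎
  where open ≤-Reasoning

module _ {x d : ℚ} (d>0 : 0ℚ < d) where

  ratio*den≡num : ratio x d d>0 * d ≡ x
  ratio*den≡num = trans (*-assoc x _ d) (trans (cong (x *_) (*-inverseˡ d {{pos⇒nonZero d {{positive d>0}}}})) (*-identityʳ x))

  ratio≤⇒≤* : ∀ {r} → ratio x d d>0 ≤ r → x ≤ r * d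
  ratio≤⇒≤* {r} x/d≤r = subst (_≤ r * d) ratio*den≡num (*-monoʳ-≤-nonNeg d {{nonNegative (<⇒≤ d>0)}} x/d≤r)

  1≤ratio : d ≤ x → 1ℚ ≤ ratio x d d>0
  1≤ratio d≤x = *-cancelʳ-≤-pos d {{positive d>0}} (subst₂ _≤_ (sym (*-identityˡ d)) (sym ratio*den≡num) d≤x)

  ratio-nonNeg : 0ℚ ≤ x → 0ℚ ≤ ratio x d d>0
  ratio-nonNeg 0≤x = *-cancelʳ-≤-pos d {{positive d>0}} (subst₂ _≤_ (sym (*-zeroˡ d)) (sym ratio*den≡num) 0≤x)

copies-fitting : ∀ {d} w (d>0 : 0ℚ < d) → 0ℚ ≤ w → Σ[ m ∈ ℕ ] d * ℕ→ℚ m ≤ w × w < d * ℕ→ℚ (suc m)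
copies-fitting {d} w d>0 0≤w =
  m , subst (d * ℕ→ℚ m ≤_) d*w/d≡w (*-monoˡ-≤-nonNeg d {{nonNegative (<⇒≤ d>0)}} (proj₁ (proj₂ (proj₂ ⌊w/d⌋))))
    , subst (_< d * ℕ→ℚ (suc m)) d*w/d≡w (*-monoʳ-<-pos d {{positive d>0}} (proj₂ (proj₂ (proj₂ ⌊w/d⌋))))
  where
  ⌊w/d⌋ : Σ[ m ∈ ℕ ] ⌊ ratio w d d>0 ⌋ℚ ≡ ℕ→ℚ m × ℕ→ℚ m ≤ ratio w d d>0 × ratio w d d>0 < ℕ→ℚ (suc m)
  ⌊w/d⌋ = ⌊⌋ℚ-nonNeg (ratio w d d>0) (ratio-nonNeg d>0 0≤w)
  m : ℕ
  m = proj₁ ⌊w/d⌋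
  d*w/d≡w : d * ratio w d d>0 ≡ w
  d*w/d≡w = trans (*-comm d _) (ratio*den≡num d>0)

sumFin≡sum : ∀ n (f : Fin n → ℚ) → sumFin n f ≡ sum f
sumFin≡sum zero    f = refl
sumFin≡sum (suc n) f = cong (_+_ (f zero)) (sumFin≡sum n (f ∘ suc))

sum-mono-≤ : ∀ {n} {f g : Fin n → ℚ} → (∀ i → f i ≤ g i) → sum f ≤ sum g
sum-mono-≤ {zero}  f≤g = ≤-refl
sum-mono-≤ {suc n} f≤g = +-mono-≤ (f≤g zero) (sum-mono-≤ (f≤g ∘ suc))

ℕ→ℚ-homo-sum : ∀ {n} (g : Fin n → ℕ) → ℕ→ℚ (ℕΣ.sum g) ≡ sum (ℕ→ℚ ∘ g)
ℕ→ℚ-homo-sum {zero}  g = refl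
ℕ→ℚ-homo-sum {suc n} g = trans (ℕ→ℚ-homo-+ (g zero) _) (cong (_+_ (ℕ→ℚ (g zero))) (ℕ→ℚ-homo-sum (g ∘ suc)))

weight : ∀ {n} → (Fin n → ℚ) → (Fin n → ℕ) → ℚ
weight w x = sum (λ a → w a * ℕ→ℚ (x a))

weighted-≤ : ∀ {u u′} k → k ≡ 0 ⊎ u ≤ u′ → u * ℕ→ℚ k ≤ u′ * ℕ→ℚ k
weighted-≤ {u} {u′} _ (inj₁ refl) = ≤-reflexive (trans (*-zeroʳ u) (sym (*-zeroʳ u′)))
weighted-≤          k (inj₂ u≤u′) = *-monoʳ-≤-nonNeg (ℕ→ℚ k) {{nonNegative (ℕ→ℚ-nonNeg k)}} u≤u′

weight-mono-≤ : ∀ {n} {w w′ : Fin n → ℚ} x → (∀ a → x a ≡ 0 ⊎ w a ≤ w′ a) → weight w x ≤ weight w′ x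
weight-mono-≤ x h = sum-mono-≤ (λ a → weighted-≤ (x a) (h a))

weight-*ˡ : ∀ {n} c (w : Fin n → ℚ) x → weight (λ a → c * w a) x ≡ c * weight w x
weight-*ˡ c w x = trans (sum-cong-≗ (λ a → *-assoc c (w a) (ℕ→ℚ (x a)))) (sym (*-distribˡ-sum c (λ a → w a * ℕ→ℚ (x a))))

copies : ∀ {n} → Fin n → ℕ → Fin n → ℕ
copies zero    k zero    = k
copies zero    k (suc b) = 0
copies (suc a) k zero    = 0
copies (suc a) k (suc b) = copies a k b

copies-≢ : ∀ {n} (a b : Fin n) {k} → (a ≡ b → k ≡ 0) → copies a k b ≡ 0
copies-≢ zero    zero    a≡b⇒k≡0 = a≡b⇒k≡0 refl
copies-≢ zero    (suc b) _       = refl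
copies-≢ (suc a) zero    _       = refl
copies-≢ (suc a) (suc b) a≡b⇒k≡0 = copies-≢ a b (a≡b⇒k≡0 ∘ cong suc)

weight-copies : ∀ {n} (w : Fin n → ℚ) a k → weight w (copies a k) ≡ w a * ℕ→ℚ k
weight-copies {suc n} w zero k = begin
  w zero * ℕ→ℚ k + sum {n} (λ b → w (suc b) * 0ℚ)   ≡⟨ cong (_+_ (w zero * ℕ→ℚ k)) (sum-cong-≗ (λ b → *-zeroʳ (w (suc b)))) ⟩
  w zero * ℕ→ℚ k + sum {n} (λ _ → 0ℚ)             ≡⟨ cong (_+_ (w zero * ℕ→ℚ k)) (sum-replicate-zero n) ⟩
  w zero * ℕ→ℚ k + 0ℚ                         ≡⟨ +-identityʳ _ ⟩
  w zero * ℕ→ℚ k                              ∎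
  where open ≡-Reasoning
weight-copies {suc n} w (suc a) k =
  trans (cong₂ _+_ (*-zeroʳ (w zero)) (weight-copies (w ∘ suc) a k)) (+-identityˡ _)

push : ∀ {m n} → (Fin m → Fin n) → (Fin m → ℕ) → Fin n → ℕ
push rep x b = ℕΣ.sum (λ a → copies (rep a) (x a) b)

push-≡0 : ∀ {m n} (rep : Fin m → Fin n) (x : Fin m → ℕ) b → (∀ a → rep a ≡ b → x a ≡ 0) → push rep x b ≡ 0
push-≡0 {m} rep x b h = trans (ℕΣ.sum-cong-≗ (λ a → copies-≢ (rep a) b (h a))) (ℕΣ.sum-replicate-zero m)

weight-push : ∀ {m n} (w : Fin n → ℚ) (rep : Fin m → Fin n) (x : Fin m → ℕ) →
              weight w (push rep x) ≡ sum (λ a → w (rep a) * ℕ→ℚ (x a))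
weight-push {m} {n} w rep x = begin
  sum (λ b → w b * ℕ→ℚ (ℕΣ.sum (y b)))
    ≡⟨ sum-cong-≗ (λ b → trans (cong (w b *_) (ℕ→ℚ-homo-sum (y b))) (*-distribˡ-sum (w b) (ℕ→ℚ ∘ y b))) ⟩
  sum (λ b → sum (λ a → w b * ℕ→ℚ (y b a)))
    ≡⟨ ∑-comm (λ b a → w b * ℕ→ℚ (y b a)) ⟩
  sum (λ a → weight w (copies (rep a) (x a)))
    ≡⟨ sum-cong-≗ (λ a → weight-copies w (rep a) (x a)) ⟩
  sum (λ a → w (rep a) * ℕ→ℚ (x a))      ∎
  where
  open ≡-Reasoning
  y : Fin n → Fin m → ℕ
  y b a = copies (rep a) (x a) b

module _ {n : ℕ} (p s : Fin n → ℚ) where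

  profitOf≡weight : ∀ x → profitOf p s x ≡ weight p x
  profitOf≡weight x = sumFin≡sum n _

  sizeOf≡weight : ∀ x → sizeOf p s x ≡ weight s x
  sizeOf≡weight x = sumFin≡sum n _

  OPT-exchange : ∀ {J I′ : Fin n → Set} {v o o′} c → Decidable J →
                 (∀ a → J a → Σ[ b ∈ Fin n ] I′ b × s b ≤ s a × c * p a ≤ p b) →
                 IsOPT p s J v o → IsOPT p s I′ v o′ → c * o ≤ o′
  OPT-exchange {J} {I′} {v} {o} {o′} c J? replace ((x , (x∈J , x-fits) , x-profit) , _) (_ , o′-max) = begin
    c * o                                  ≡⟨ cong (c *_) (trans (sym x-profit) (profitOf≡weight x)) ⟩
    c * weight p x                         ≡⟨ weight-*ˡ c p x ⟨
    weight (λ a → c * p a) x               ≤⟨ weight-mono-≤ x (λ a → Sum.map₂ (proj₂ ∘ proj₂) (rep-good a)) ⟩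
    sum (λ a → p (rep a) * ℕ→ℚ (x a))      ≡⟨ trans (profitOf≡weight y) (weight-push p rep x) ⟨
    profitOf p s y                         ≤⟨ o′-max y (y∈I′ , y-fits) ⟩
    o′                                     ∎
    where
    open ≤-Reasoning
    Good : Fin n → Fin n → Set
    Good a b = I′ b × s b ≤ s a × c * p a ≤ p b
    choose : ∀ a → Dec (J a) → Σ[ b ∈ Fin n ] (x a ≡ 0 ⊎ Good a b)
    choose a (yes a∈J) = Product.map₂ inj₂ (replace a a∈J)
    choose a (no  a∉J) = a , inj₁ (x∈J a a∉J)
    rep : Fin n → Fin n
    rep a = proj₁ (choose a (J? a))
    rep-good : ∀ a → x a ≡ 0 ⊎ Good a (rep a)
    rep-good a = proj₂ (choose a (J? a))
    y : Fin n → ℕ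
    y = push rep x
    y∈I′ : ∀ b → ¬ I′ b → y b ≡ 0
    y∈I′ b b∉I′ = push-≡0 rep x b λ a rep[a]≡b →
      Sum.[ id , (λ good → contradiction (subst I′ rep[a]≡b (proj₁ good)) b∉I′) ] (rep-good a)
    y-fits : sizeOf p s y ≤ v
    y-fits = begin
      sizeOf p s y                        ≡⟨ trans (sizeOf≡weight y) (weight-push s rep x) ⟩
      sum (λ a → s (rep a) * ℕ→ℚ (x a))  ≤⟨ weight-mono-≤ x (λ a → Sum.map₂ (proj₁ ∘ proj₂) (rep-good a)) ⟩
      weight s x                          ≡⟨ sizeOf≡weight x ⟨
      sizeOf p s x                        ≤⟨ x-fits ⟩
      v                                   ∎

module _ {n : ℕ} (p s : Fin n → ℚ) (s-pos : ∀ a → 0ℚ < s a) where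

  efficiency : Fin n → ℚ
  efficiency a = ratio (p a) (s a) (s-pos a)

  profit≤efficiency*size : ∀ {J : Fin n → Set} r x → (∀ a → J a → efficiency a ≤ r) →
                           (∀ a → ¬ J a → x a ≡ 0) → profitOf p s x ≤ r * sizeOf p s x
  profit≤efficiency*size r x bound x∈J = begin
    profitOf p s x             ≡⟨ profitOf≡weight p s x ⟩
    weight p x                 ≤⟨ weight-mono-≤ x below-r ⟩
    weight (λ a → r * s a) x   ≡⟨ weight-*ˡ r s x ⟩
    r * weight s x             ≡⟨ cong (r *_) (sizeOf≡weight p s x) ⟨
    r * sizeOf p s x           ∎
    where
    open ≤-Reasoning
    below-r : ∀ a → x a ≡ 0 ⊎ p a ≤ r * s a
    below-r a with efficiency a ≤? r
    ... | yes eff≤r = inj₂ (ratio≤⇒≤* (s-pos a) eff≤r)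
    ... | no  eff≰r = inj₁ (x∈J a (eff≰r ∘ bound a))

  OPT-single-item : ∀ {J : Fin n → Set} e {w o₁ o₂} → 0ℚ ≤ w → 0ℚ ≤ p e →
                    (∀ a → J a → efficiency a ≤ efficiency e) →
                    IsOPT p s (_≡ e) w o₁ → IsOPT p s J w o₂ → o₂ ≤ o₁ + p e
  OPT-single-item e {w} {o₁} {o₂} 0≤w 0≤pe e-max (_ , o₁-max) ((x , (x∈J , x-fits) , x-profit) , _) = begin
    o₂                                  ≡⟨ x-profit ⟨
    profitOf p s x                      ≤⟨ profit≤efficiency*size r x e-max x∈J ⟩
    r * sizeOf p s x                    ≤⟨ *-monoˡ-≤-nonNeg r {{nonNegative 0≤r}} x-fits ⟩
    r * w                               ≤⟨ *-monoˡ-≤-nonNeg r {{nonNegative 0≤r}} (<⇒≤ (proj₂ (proj₂ fit))) ⟩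
    r * (s e * ℕ→ℚ (suc m))             ≡⟨ trans (sym (*-assoc r (s e) (ℕ→ℚ (suc m)))) (cong (_* ℕ→ℚ (suc m)) (ratio*den≡num {p e} (s-pos e))) ⟩
    p e * ℕ→ℚ (suc m)                   ≡⟨ cong (p e *_) (ℕ→ℚ-suc m) ⟩
    p e * (1ℚ + ℕ→ℚ m)                  ≡⟨ solve 2 (λ a b → a :* (con 1ℚ :+ b) := a :* b :+ a) refl (p e) (ℕ→ℚ m) ⟩
    p e * ℕ→ℚ m + p e                   ≡⟨ cong (_+ p e) y-profit ⟨
    profitOf p s y + p e                ≤⟨ +-monoˡ-≤ (p e) (o₁-max y (y∈e , y-fits)) ⟩
    o₁ + p e                            ∎
    where
    open ≤-Reasoning
    r : ℚ
    r = efficiency e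
    0≤r : 0ℚ ≤ r
    0≤r = ratio-nonNeg (s-pos e) 0≤pe
    fit : Σ[ m ∈ ℕ ] s e * ℕ→ℚ m ≤ w × w < s e * ℕ→ℚ (suc m)
    fit = copies-fitting w (s-pos e) 0≤w
    m : ℕ
    m = proj₁ fit
    y : Fin n → ℕ
    y = copies e m
    y∈e : ∀ b → ¬ b ≡ e → y b ≡ 0
    y∈e b b≢e = copies-≢ e b (λ e≡b → contradiction (sym e≡b) b≢e)
    y-profit : profitOf p s y ≡ p e * ℕ→ℚ m
    y-profit = trans (profitOf≡weight p s y) (weight-copies p e m)
    y-fits : sizeOf p s y ≤ w
    y-fits = subst (_≤ w) (sym (trans (sizeOf≡weight p s y) (weight-copies s e m))) (proj₁ (proj₂ fit))

  greedyProfit : Fin n → ℚ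
  greedyProfit a = p a * ⌊ ratio 1ℚ (s a) (s-pos a) ⌋ℚ

  greedyProfit-bounds : ∀ e → (∀ a → s a ≤ 1ℚ) → 0ℚ < p e → (∀ a → efficiency a ≤ efficiency e) →
                        0ℚ < greedyProfit e × (∀ a → p a ≤ ℕ→ℚ 2 * greedyProfit e)
  greedyProfit-bounds e s≤1 pe>0 e-max = 0<P0 , p≤2P0
    where
    open ≤-Reasoning
    x : ℚ
    x = ratio 1ℚ (s e) (s-pos e)
    x≤2M : Σ[ m ∈ ℕ ] ⌊ x ⌋ℚ ≡ ℕ→ℚ (suc m) × x ≤ ℕ→ℚ 2 * ℕ→ℚ (suc m)
    x≤2M = x≤2⌊x⌋ x (1≤ratio (s-pos e) (s≤1 e))
    m : ℕ
    m = proj₁ x≤2M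
    M : ℚ
    M = ℕ→ℚ (suc m)
    P0≡ : greedyProfit e ≡ p e * M
    P0≡ = cong (p e *_) (proj₁ (proj₂ x≤2M))
    0<P0 : 0ℚ < greedyProfit e
    0<P0 = begin-strict
      0ℚ               ≡⟨ *-zeroʳ (p e) ⟨
      p e * 0ℚ         <⟨ *-monoʳ-<-pos (p e) {{positive pe>0}} (<-≤-trans (positive⁻¹ 1ℚ) (1≤ℕ→ℚ-suc m)) ⟩
      p e * M          ≡⟨ P0≡ ⟨
      greedyProfit e   ∎
    p≤2P0 : ∀ a → p a ≤ ℕ→ℚ 2 * greedyProfit e
    p≤2P0 a = begin
      p a                     ≤⟨ ratio≤⇒≤* (s-pos a) (e-max a) ⟩
      efficiency e * s a      ≤⟨ *-monoˡ-≤-nonNeg (efficiency e) {{nonNegative (ratio-nonNeg (s-pos e) (<⇒≤ pe>0))}} (s≤1 a) ⟩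
      efficiency e * 1ℚ       ≡⟨ trans (*-identityʳ _) (cong (p e *_) (sym (*-identityˡ _))) ⟩
      p e * x                 ≤⟨ *-monoˡ-≤-nonNeg (p e) {{nonNegative (<⇒≤ pe>0)}} (proj₂ (proj₂ x≤2M)) ⟩
      p e * (ℕ→ℚ 2 * M)       ≡⟨ solve 3 (λ a b c → a :* (b :* c) := b :* (a :* c)) refl (p e) (ℕ→ℚ 2) M ⟩
      ℕ→ℚ 2 * (p e * M)       ≡⟨ cong (ℕ→ℚ 2 *_) P0≡ ⟨
      ℕ→ℚ 2 * greedyProfit e  ∎

bracket : ∀ (f : ℕ → ℚ) {q} j → f 0 ≤ q → q < f j → Σ[ k ∈ ℕ ] k ℕ.< j × f k ≤ q × q < f (suc k)
bracket f zero    f0≤q q<f0 = contradiction (≤-<-trans f0≤q q<f0) (<-irrefl refl)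
bracket f {q} (suc j) f0≤q q<f[1+j] with f j ≤? q
... | yes fj≤q = j , ℕ.n<1+n j , fj≤q , q<f[1+j]
... | no  fj≰q = Product.map₂ (Product.map₁ ℕ.m<n⇒m<1+n) (bracket f j f0≤q (≰⇒> fj≰q))

bucket-within-level : ∀ N {T K q} A → ℕ→ℚ N * K ≡ T → A * T ≤ q → q < ℕ→ℚ 2 * A * T →
                      Σ[ γ ∈ ℕ ] γ ℕ.< N × A * T + ℕ→ℚ γ * A * K ≤ q × q < A * T + ℕ→ℚ (suc γ) * A * K
bucket-within-level N {T} {K} {q} A NK≡T AT≤q q<2AT =
  bracket (λ γ → A * T + ℕ→ℚ γ * A * K) N (subst (_≤ q) first AT≤q) (subst (q <_) last q<2AT)
  where
  open ≡-Reasoning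
  first : A * T ≡ A * T + ℕ→ℚ 0 * A * K
  first = begin
    A * T                     ≡⟨ +-identityʳ (A * T) ⟨
    A * T + 0ℚ                ≡⟨ cong (_+_ (A * T)) (trans (cong (_* K) (*-zeroˡ A)) (*-zeroˡ K)) ⟨
    A * T + ℕ→ℚ 0 * A * K     ∎
  last : ℕ→ℚ 2 * A * T ≡ A * T + ℕ→ℚ N * A * K
  last = begin
    ℕ→ℚ 2 * A * T             ≡⟨ trans (*-assoc (ℕ→ℚ 2) A T) (ℕ→ℚ-2* (A * T)) ⟩
    A * T + A * T             ≡⟨ cong (λ t → A * T + A * t) NK≡T ⟨
    A * T + A * (ℕ→ℚ N * K)   ≡⟨ solve 4 (λ a t n k → a :* t :+ a :* (n :* k) := a :* t :+ n :* a :* k) refl A T (ℕ→ℚ N) K ⟩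
    A * T + ℕ→ℚ N * A * K     ∎

InL-cover : ∀ κ {T K P0 q} → ℕ→ℚ (2 ^ suc κ ℕ.* suc κ) * K ≡ T → ℕ→ℚ (2 ^ suc κ) * T ≡ ℕ→ℚ 2 * P0 →
            T ≤ q → q ≤ ℕ→ℚ 2 * P0 → Σ[ k ∈ ℕ ] Σ[ γ ∈ ℕ ] ValidIdx κ k γ × InL κ T K P0 k γ q
InL-cover κ {T} {K} {P0} {q} NK≡T top≡2P0 T≤q q≤2P0 = classify (q <? ℕ→ℚ 2 * P0)
  where
  classify : Dec (q < ℕ→ℚ 2 * P0) → Σ[ k ∈ ℕ ] Σ[ γ ∈ ℕ ] ValidIdx κ k γ × InL κ T K P0 k γ q
  classify (no  q≮2P0) = suc κ , 0 , inj₂ (refl , refl) , inj₂ (refl , refl , ≤-antisym q≤2P0 (≮⇒≥ q≮2P0))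
  classify (yes q<2P0) =
    let k , k<1+κ , 2^kT≤q , q<2^[1+k]T = bracket (λ k → ℕ→ℚ (2 ^ k) * T) (suc κ)
                                            (subst (_≤ q) (sym (*-identityˡ T)) T≤q) (subst (q <_) (sym top≡2P0) q<2P0)
        γ , γ<N , lo , hi = bucket-within-level (2 ^ suc κ ℕ.* suc κ) (ℕ→ℚ (2 ^ k)) NK≡T 2^kT≤q
                              (subst (q <_) (cong (_* T) (ℕ→ℚ-homo-* 2 (2 ^ k))) q<2^[1+k]T)
    in k , γ , inj₁ (ℕ.≤-pred k<1+κ , γ<N) , inj₁ (ℕ.≤-pred k<1+κ , γ<N , lo , hi)

InL-close : ∀ κ {T K P0 δ k γ q q′} → K ≡ δ * T → 0ℚ ≤ δ → 0ℚ ≤ T → 0ℚ ≤ q →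
            InL κ T K P0 k γ q → InL κ T K P0 k γ q′ → (1ℚ - δ) * q ≤ q′
InL-close κ {T} {K} {P0} {δ} {k} {γ} {q} {q′} K≡δT 0≤δ 0≤T _ (inj₁ (_ , _ , lo , hi)) (inj₁ (_ , _ , lo′ , _)) =
  q≤q′+δq⇒[1-δ]q≤q′ δ (<⇒≤ (begin-strict
    q                               <⟨ hi ⟩
    A * T + ℕ→ℚ (suc γ) * A * K     ≡⟨ cong (λ g → A * T + g * A * K) (ℕ→ℚ-suc γ) ⟩
    A * T + (1ℚ + G) * A * K        ≡⟨ solve 4 (λ a t g k → a :* t :+ (con 1ℚ :+ g) :* a :* k
                                                         := (a :* t :+ g :* a :* k) :+ a :* k) refl A T G K ⟩
    A * T + G * A * K + A * K       ≤⟨ +-mono-≤ lo′ AK≤δq ⟩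
    q′ + δ * q                      ∎))
  where
  open ≤-Reasoning
  A G : ℚ
  A = ℕ→ℚ (2 ^ k)
  G = ℕ→ℚ γ
  0≤K : 0ℚ ≤ K
  0≤K = subst (0ℚ ≤_) (sym K≡δT) (*-nonNeg 0≤δ 0≤T)
  AT≤q : A * T ≤ q
  AT≤q = ≤-trans (p≤p+q (*-nonNeg (*-nonNeg (ℕ→ℚ-nonNeg γ) (ℕ→ℚ-nonNeg (2 ^ k))) 0≤K)) lo
  AK≤δq : A * K ≤ δ * q
  AK≤δq = begin
    A * K          ≡⟨ trans (cong (A *_) K≡δT) (solve 3 (λ a d t → a :* (d :* t) := d :* (a :* t)) refl A δ T) ⟩
    δ * (A * T)    ≤⟨ *-monoˡ-≤-nonNeg δ {{nonNegative 0≤δ}} AT≤q ⟩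
    δ * q          ∎
InL-close κ _ _ _ _ (inj₁ (k≤κ , _)) (inj₂ (refl , _)) = contradiction k≤κ (ℕ.<-irrefl refl)
InL-close κ _ _ _ _ (inj₂ (refl , _)) (inj₁ (k≤κ , _)) = contradiction k≤κ (ℕ.<-irrefl refl)
InL-close κ {δ = δ} {q = q} {q′} _ 0≤δ _ 0≤q (inj₂ (_ , _ , q≡2P0)) (inj₂ (_ , _ , q′≡2P0)) =
  q≤q′+δq⇒[1-δ]q≤q′ δ (subst (_≤ q′ + δ * q) (trans q′≡2P0 (sym q≡2P0)) (p≤p+q (*-nonNeg 0≤δ 0≤q)))

large-item-representative :
  ∀ {n} (p s : Fin n → ℚ) κ {T K P0 δ} (sel : ℕ → ℕ → Maybe (Fin n)) →
  ℕ→ℚ (2 ^ suc κ ℕ.* suc κ) * K ≡ T → ℕ→ℚ (2 ^ suc κ) * T ≡ ℕ→ℚ 2 * P0 → K ≡ δ * T → 0ℚ ≤ δ → 0ℚ ≤ T →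
  (∀ a → p a ≤ ℕ→ℚ 2 * P0) →
  (∀ k γ → ValidIdx κ k γ →
     (sel k γ ≡ nothing × (∀ a → T ≤ p a → ¬ InL κ T K P0 k γ (p a)))
     ⊎ (Σ (Fin n) λ b → sel k γ ≡ just b × T ≤ p b × InL κ T K P0 k γ (p b)
          × (∀ a → T ≤ p a → InL κ T K P0 k γ (p a) → s b ≤ s a))) →
  ∀ a → T ≤ p a →
  Σ[ b ∈ Fin n ] (Σ ℕ λ k → Σ ℕ λ γ → ValidIdx κ k γ × sel k γ ≡ just b) × s b ≤ s a × (1ℚ - δ) * p a ≤ p b
large-item-representative {n} p s κ {T} {K} {P0} {δ} sel NK≡T top≡2P0 K≡δT 0≤δ 0≤T p≤2P0 sel-min a T≤pa =
  pick (InL-cover κ {T} {K} {P0} NK≡T top≡2P0 T≤pa (p≤2P0 a))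
  where
  Representative : Set
  Representative =
    Σ[ b ∈ Fin n ] (Σ ℕ λ k → Σ ℕ λ γ → ValidIdx κ k γ × sel k γ ≡ just b) × s b ≤ s a × (1ℚ - δ) * p a ≤ p b
  pick : (Σ[ k ∈ ℕ ] Σ[ γ ∈ ℕ ] ValidIdx κ k γ × InL κ T K P0 k γ (p a)) → Representative
  pick (k , γ , valid , a∈L) = Sum.[
      (λ (_ , L-empty) → contradiction a∈L (L-empty a T≤pa)) ,
      (λ (b , sel≡b , _ , b∈L , b-min) →
         b , (k , γ , valid , sel≡b) , b-min a T≤pa a∈L ,
         InL-close κ {T} {K} {P0} {δ} {k} {γ} {p a} {p b} K≡δT 0≤δ 0≤T (≤-trans 0≤T T≤pa) a∈L b∈L) ]
    (sel-min k γ valid)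

2^[2+k]T≡2P0 : ∀ k {P0 T} → T ≡ ½ * 1/2^ k * P0 → ℕ→ℚ (2 ^ suc (suc k)) * T ≡ ℕ→ℚ 2 * P0
2^[2+k]T≡2P0 k {P0} refl = begin
  ℕ→ℚ (2 ^ suc (suc k)) * (½ * ε * P0)   ≡⟨ cong (_* (½ * ε * P0)) (ℕ→ℚ-2^[2+k] k) ⟩
  two * (two * E) * (½ * ε * P0)          ≡⟨ solve 5 (λ t E h e P → t :* (t :* E) :* (h :* e :* P)
                                                      := (t :* P) :* ((t :* h) :* (e :* E))) refl two E ½ ε P0 ⟩
  two * P0 * ((two * ½) * (ε * E))        ≡⟨ cong (λ z → two * P0 * ((two * ½) * z)) (1/2^*2^≡1 k) ⟩
  two * P0 * 1ℚ                           ≡⟨ *-identityʳ (two * P0) ⟩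
  two * P0                                ∎
  where
  open ≡-Reasoning
  two ε E : ℚ
  two = ℕ→ℚ 2
  ε = 1/2^ k
  E = ℕ→ℚ (2 ^ k)

bucket-count*width≡T : ∀ k {T K} → K ≡ (+ 1 / 4) * (+ 1 / suc (suc k)) * 1/2^ k * T →
                       ℕ→ℚ (2 ^ suc (suc k) ℕ.* suc (suc k)) * K ≡ T
bucket-count*width≡T k {T} refl = begin
  ℕ→ℚ (2 ^ suc (suc k) ℕ.* suc (suc k)) * (¼ * c * ε * T)  ≡⟨ cong (_* (¼ * c * ε * T)) (trans (ℕ→ℚ-homo-* (2 ^ suc (suc k)) _)
                                                                 (cong (_* C) (ℕ→ℚ-2^[2+k] k))) ⟩
  two * (two * E) * C * (¼ * c * ε * T)    ≡⟨ solve 7 (λ t E C f c e T → t :* (t :* E) :* C :* (f :* c :* e :* T)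
                                                := (t :* t :* f) :* ((e :* E) :* (c :* C)) :* T) refl two E C ¼ c ε T ⟩
  (two * two * ¼) * ((ε * E) * (c * C)) * T  ≡⟨ cong₂ (λ u v → (two * two * ¼) * (u * v) * T) (1/2^*2^≡1 k) (1/n*n≡1 (suc (suc k))) ⟩
  1ℚ * T                                     ≡⟨ *-identityˡ T ⟩
  T                                          ∎
  where
  open ≡-Reasoning
  two ¼ ε E C c : ℚ
  two = ℕ→ℚ 2
  ¼ = + 1 / 4
  ε = 1/2^ k
  E = ℕ→ℚ (2 ^ k)
  C = ℕ→ℚ (suc (suc k))
  c = + 1 / suc (suc k)

lemma1 : (n : ℕ) (p s : Fin n → ℚ)
         (p-pos : ∀ a → 0ℚ < p a) (p-le1 : ∀ a → p a ≤ 1ℚ)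
         (s-pos : ∀ a → 0ℚ < s a) (s-le1 : ∀ a → s a ≤ 1ℚ)
         (κ : ℕ) (ε : ℚ) → ε ≡ 1/2^ (κ ∸ 1) → ε ≤ + 1 / 4 →
         (ame : Fin n) →
         (∀ a → ratio (p a) (s a) (s-pos a) ≤ ratio (p ame) (s ame) (s-pos ame)) →
         (P0 T K : ℚ) →
         P0 ≡ p ame * ⌊ ratio 1ℚ (s ame) (s-pos ame) ⌋ℚ →
         T ≡ ½ * ε * P0 →
         K ≡ (+ 1 / 4) * (+ 1 / suc κ) * ε * T →
         (aeff : Fin n) → p aeff < T →
         (∀ a → p a < T → ratio (p a) (s a) (s-pos a) ≤ ratio (p aeff) (s aeff) (s-pos aeff)) →
         (sel : ℕ → ℕ → Maybe (Fin n)) →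
         (∀ k γ → ValidIdx κ k γ →
            (sel k γ ≡ nothing × (∀ a → T ≤ p a → ¬ InL κ T K P0 k γ (p a)))
            ⊎ (Σ (Fin n) λ b → sel k γ ≡ just b × T ≤ p b × InL κ T K P0 k γ (p b)
                 × (∀ a → T ≤ p a → InL κ T K P0 k γ (p a) → s b ≤ s a))) →
         (v : ℚ) → 0ℚ ≤ v → v ≤ 1ℚ →
         (∀ o₁ o₂ → IsOPT p s (λ a → a ≡ aeff) (1ℚ - v) o₁
                  → IsOPT p s (λ a → p a < T) (1ℚ - v) o₂
                  → o₂ - T ≤ o₁)
         × (∀ o₃ o₄ → IsOPT p s (λ a → Σ ℕ λ k → Σ ℕ λ γ → ValidIdx κ k γ × sel k γ ≡ just a) v o₃
                    → IsOPT p s (λ a → T ≤ p a) v o₄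
                    → (1ℚ - ε * (+ 1 / 4) * (+ 1 / suc κ)) * o₄ ≤ o₃)
-- ε ≤ 1/4 only serves to exclude κ = 0, where ε = 1/2^(0 ∸ 1) = 1.
lemma1 _ _ _ _ _ _ _ zero _ refl ε≤¼ = contradiction ε≤¼ λ { (*≤* (ℤ.+≤+ (ℕ.s≤s ()))) }
lemma1 n p s p-pos _ s-pos s≤1 (suc κ) _ refl _ ame ame-max P0 T K P0≡ T≡ K≡
       aeff paeff<T aeff-max sel sel-min v _ v≤1 = small-items , large-items
  where
  P0-bounds : 0ℚ < P0 × (∀ a → p a ≤ ℕ→ℚ 2 * P0)
  P0-bounds = subst (λ P → 0ℚ < P × (∀ a → p a ≤ ℕ→ℚ 2 * P)) (sym P0≡)
                (greedyProfit-bounds p s s-pos ame s≤1 (p-pos ame) ame-max)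
  0≤T : 0ℚ ≤ T
  0≤T = subst (0ℚ ≤_) (sym T≡) (<⇒≤ (*-pos (*-pos (1/n-pos 2) (1/2^-pos κ)) (proj₁ P0-bounds)))
  δ : ℚ
  δ = 1/2^ κ * (+ 1 / 4) * (+ 1 / suc (suc κ))
  0≤δ : 0ℚ ≤ δ
  0≤δ = <⇒≤ (*-pos (*-pos (1/2^-pos κ) (1/n-pos 4)) (1/n-pos (suc (suc κ))))
  K≡δT : K ≡ δ * T
  K≡δT = trans K≡ (solve 4 (λ f c e t → f :* c :* e :* t := e :* f :* c :* t) refl
                     (+ 1 / 4) (+ 1 / suc (suc κ)) (1/2^ κ) T)
  small-items : ∀ o₁ o₂ → IsOPT p s (_≡ aeff) (1ℚ - v) o₁ → IsOPT p s (λ a → p a < T) (1ℚ - v) o₂ →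
                o₂ - T ≤ o₁
  small-items o₁ o₂ opt₁ opt₂ = p≤q+r⇒p-r≤q (≤-trans
     (OPT-single-item p s s-pos aeff (p≤q⇒0≤q-p v≤1) (<⇒≤ (p-pos aeff)) aeff-max opt₁ opt₂)
     (+-monoʳ-≤ o₁ (<⇒≤ paeff<T)))
  large-items : ∀ o₃ o₄ → IsOPT p s (λ b → Σ ℕ λ k → Σ ℕ λ γ → ValidIdx (suc κ) k γ × sel k γ ≡ just b) v o₃ →
                IsOPT p s (λ a → T ≤ p a) v o₄ → (1ℚ - δ) * o₄ ≤ o₃
  large-items o₃ o₄ opt₃ opt₄ = OPT-exchange p s (1ℚ - δ) (λ a → T ≤? p a)
     (large-item-representative p s (suc κ) {T} {K} {P0} {δ} sel (bucket-count*width≡T κ K≡) (2^[2+k]T≡2P0 κ T≡)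
        K≡δT 0≤δ 0≤T (proj₂ P0-bounds) sel-min)
     opt₄ opt₃
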